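{- Let $G$ be a finite simple graph of diameter $4$. The following are equivalent: (i) $d(G)=\infty$; (ii) $G$ accumulates $C_5$ or $N$, i.e. $J^k(G)$ contains $C_5$ or $N$ as a subgraph for some $k$; (iii) $G$ has at least $6$ edges.
   Context: The jump graph $J(G)$ has vertex set $E(G)$, two vertices adjacent iff the corresponding edges of $G$ share no endpoint; $J^0(G)=G$, $J^k(G)=J(J^{k-1}(G))$. The dissipation number $d(G)$ is the smallest $k\ge0$ with $J^k(G)$ the empty graph (no vertices), or $\infty$ if none exists. $C_5$ is the 5-cycle; the net graph $N$ is a triangle with one pendant edge at each of its three vertices. Graphs differing only by isolated vertices are regarded as equal (so the diameter refers to the graph without isolated vertices, which is connected). -}

module Defs where

open import Data.Nat using (ℕ; zero; suc; _≤_; _<ᵇ_; _≡ᵇ_)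
open import Data.Bool using (Bool; true; false; _∧_; _∨_; not)
open import Data.Fin using (Fin; toℕ)
open import Data.Fin.Properties using (_≟_)
open import Data.List using (List; []; _∷_; length; filterᵇ; cartesianProduct; allFin; lookup)
open import Data.Bool.ListAction using (any)
open import Data.Sum using (_⊎_)
open import Data.Empty using (⊥)
open import Data.Product using (_×_; _,_; proj₁; proj₂; Σ; ∃; ∃-syntax)
open import Relation.Binary.PropositionalEquality using (_≡_)
open import Relation.Nullary using (¬_; does)
open import Function.Definitions using (Injective)

record Graph : Set where
  constructor mkGraph
  field
    n   : ℕ
    adj : Fin n → Fin n → Bool
open Graph public

IsSimple : Graph → Set
IsSimple G = (∀ u v → adj G u v ≡ adj G v u) × (∀ u → adj G u u ≡ false)

edges : (G : Graph) → List (Fin (n G) × Fin (n G))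
edges G = filterᵇ (λ p → (toℕ (proj₁ p) <ᵇ toℕ (proj₂ p)) ∧ adj G (proj₁ p) (proj₂ p))
                  (cartesianProduct (allFin (n G)) (allFin (n G)))

edgeCount : Graph → ℕ
edgeCount G = length (edges G)

disjointᵇ : {m : ℕ} → Fin m × Fin m → Fin m × Fin m → Bool
disjointᵇ (a , b) (c , d) =
  not (does (a ≟ c)) ∧ not (does (a ≟ d)) ∧ not (does (b ≟ c)) ∧ not (does (b ≟ d))

J : Graph → Graph
J G = mkGraph (length (edges G)) (λ e f → disjointᵇ (lookup (edges G) e) (lookup (edges G) f))

J^ : ℕ → Graph → Graph
J^ zero G = G
J^ (suc k) G = J (J^ k G)

DissipationInfinite : Graph → Set
DissipationInfinite G = ¬ (∃[ k ] n (J^ k G) ≡ 0)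

fromEdgeList : (m : ℕ) → List (ℕ × ℕ) → Graph
fromEdgeList m es = mkGraph m (λ u v → any (λ p →
    ((proj₁ p ≡ᵇ toℕ u) ∧ (proj₂ p ≡ᵇ toℕ v)) ∨ ((proj₁ p ≡ᵇ toℕ v) ∧ (proj₂ p ≡ᵇ toℕ u))) es)

C5 : Graph
C5 = fromEdgeList 5 ((0 , 1) ∷ (1 , 2) ∷ (2 , 3) ∷ (3 , 4) ∷ (4 , 0) ∷ [])

Net : Graph
Net = fromEdgeList 6 ((0 , 1) ∷ (1 , 2) ∷ (2 , 0) ∷ (0 , 3) ∷ (1 , 4) ∷ (2 , 5) ∷ [])

SubgraphOf : Graph → Graph → Set
SubgraphOf H G = Σ (Fin (n H) → Fin (n G)) λ f →
  Injective _≡_ _≡_ f × (∀ a b → adj H a b ≡ true → adj G (f a) (f b) ≡ true)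

AccumulatesC5orNet : Graph → Set
AccumulatesC5orNet G = ∃[ k ] (SubgraphOf C5 (J^ k G) ⊎ SubgraphOf Net (J^ k G))

data Walk (G : Graph) : ℕ → Fin (n G) → Fin (n G) → Set where
  here : ∀ {u} → Walk G zero u u
  step : ∀ {k u w v} → adj G u w ≡ true → Walk G k w v → Walk G (suc k) u v

DistLe : (G : Graph) → ℕ → Fin (n G) → Fin (n G) → Set
DistLe G k u v = ∃[ j ] (j ≤ k × Walk G j u v)

NonIsolated : (G : Graph) → Fin (n G) → Set
NonIsolated G u = ∃[ w ] adj G u w ≡ true

-- Diameter of G after discarding isolated vertices is exactly d (d ≥ 1):
-- all non-isolated vertices are within distance d (so the graph is connected),
-- and some pair of non-isolated vertices is at distance > d - 1.
HasDiameter : Graph → ℕ → Set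
HasDiameter G zero = ⊥
HasDiameter G (suc d) =
  (∀ u v → NonIsolated G u → NonIsolated G v → DistLe G (suc d) u v) ×
  (∃[ u ] ∃[ v ] (NonIsolated G u × NonIsolated G v × ¬ DistLe G d u v))

-- Fix a geodesic v₀ v₁ v₂ v₃ v₄ of G. Its four edges induce the path
-- e₂ – e₀ – e₃ – e₁ in J(G), and since a chord would shorten the geodesic,
-- every other edge of G has an endpoint off the path.
--
-- If G has at least six edges, take two extra edges. Collapsing v₀ onto v₁,
-- v₄ onto v₃ and every vertex off the path onto one new vertex can only
-- destroy disjointness, so J(G) contains the jump graph of P₅ with two pendant
-- edges at inner path vertices sharing their outer end. Each of these nine
-- graphs reaches C₅ within two further jumps. Since C₅ and the net embed in
-- their own jump graphs, once one of them appears it survives forever and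
-- d(G) = ∞.
--
-- If G has at most five edges there is at most one extra edge. The diameter
-- bound forces it to hang from v₁, v₂ or v₃ (at v₀, at v₄, or detached from
-- the path it would create a pair of vertices at distance > 4), and then J(G)
-- embeds in the jump graph of P₅ plus that pendant edge, which dissipates.
module Submission where

open import Defs
open import Data.Nat as ℕ using (ℕ; zero; suc; _+_; _∸_; _≤_; _<_; _<ᵇ_; z≤n; s≤s)
import Data.Nat.Properties as ℕ
open import Data.Bool using (Bool; true; false; _∧_; _∨_; T; if_then_else_)
import Data.Bool.Properties as Bool
open import Data.Fin as Fin using (Fin; zero; suc; toℕ; inject₁; fromℕ; #_)
open import Data.Fin.Properties
  using (_≟_; toℕ-injective; toℕ-inject₁; toℕ≤pred[n]; inject₁-injective; injective⇒≤; any?; all?)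
open import Data.List using (List; []; _∷_; _++_; length; lookup; filter; cartesianProduct; allFin; tabulate)
open import Data.List.Properties using (length-++)
open import Data.List.Membership.Propositional using (_∈_; _∉_)
open import Data.List.Membership.Propositional.Properties
  using (∈-lookup; ∈-filter⁻; ∈-filter⁺; ∈-cartesianProduct⁺; ∈-allFin; ∈-++⁺ˡ; ∈-++⁺ʳ; ∈-++⁻; ∈-tabulate⁺; ∈-tabulate⁻)
open import Data.List.Relation.Unary.Any as Any using (here; there; index)
open import Data.List.Relation.Unary.Any.Properties using (lookup-index)
open import Data.List.Relation.Unary.All as All using ([]; _∷_)
open import Data.List.Relation.Unary.AllPairs using ([]; _∷_)
open import Data.List.Relation.Unary.Unique.Propositional using (Unique)
open import Data.List.Relation.Unary.Unique.Propositional.Properties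
  using (++⁺; filter⁺; tabulate⁺; cartesianProduct⁺; allFin⁺)
open import Data.Vec as Vec using ([]; _∷_)
open import Data.Product as Prod using (Σ; _×_; _,_; proj₁; proj₂; ∃; ∃₂; ∃-syntax)
open import Data.Product.Properties using (≡-dec)
open import Data.Sum as Sum using (_⊎_; inj₁; inj₂)
open import Data.Empty using (⊥; ⊥-elim)
open import Function using (_∘_; id)
open import Function.Bundles using (_⇔_; mk⇔; Equivalence)
open import Function.Definitions using (Injective)
open import Relation.Binary using (tri<; tri≈; tri>)
open import Relation.Binary.PropositionalEquality
  using (_≡_; _≢_; refl; sym; trans; cong; subst; subst₂; module ≡-Reasoning)
open import Relation.Nullary using (¬_; Dec; yes; no; does; ¬?; contradiction)
open import Relation.Nullary.Decidable using (True; T?; toWitness; dec-true; _×-dec_; _⊎-dec_; _→-dec_)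

private
  variable
    m : ℕ

Symmetric : Graph → Set
Symmetric G = ∀ u v → adj G u v ≡ adj G v u

adjacent⇒distinct : {G : Graph} → IsSimple G → ∀ {u v} → adj G u v ≡ true → u ≢ v
adjacent⇒distinct (_ , irreflexive) {u} uv refl with trans (sym (irreflexive u)) uv
... | ()

-- Vertex pairs, their ends, and disjointness

data Endpoint {A : Set} : A → A × A → Set where
  first  : ∀ {a b} → Endpoint a (a , b)
  second : ∀ {a b} → Endpoint b (a , b)

record MapsInto {A B : Set} (h : A → B) (x : A × A) (y : B × B) : Set where
  constructor maps
  field
    into₁ : Endpoint (h (proj₁ x)) y
    into₂ : Endpoint (h (proj₂ x)) y

_≈ᵉ_ : {A : Set} → A × A → A × A → Set
x ≈ᵉ y = (proj₁ x ≡ proj₁ y × proj₂ x ≡ proj₂ y) ⊎ (proj₁ x ≡ proj₂ y × proj₂ x ≡ proj₁ y)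

module _ {A : Set} where

  ≈ᵉ-sym : {x y : A × A} → x ≈ᵉ y → y ≈ᵉ x
  ≈ᵉ-sym (inj₁ (p , q)) = inj₁ (sym p , sym q)
  ≈ᵉ-sym (inj₂ (p , q)) = inj₂ (sym q , sym p)

  ≈ᵉ-trans : {x y z : A × A} → x ≈ᵉ y → y ≈ᵉ z → x ≈ᵉ z
  ≈ᵉ-trans (inj₁ (p , q)) (inj₁ (r , s)) = inj₁ (trans p r , trans q s)
  ≈ᵉ-trans (inj₁ (p , q)) (inj₂ (r , s)) = inj₂ (trans p r , trans q s)
  ≈ᵉ-trans (inj₂ (p , q)) (inj₁ (r , s)) = inj₂ (trans p s , trans q r)
  ≈ᵉ-trans (inj₂ (p , q)) (inj₂ (r , s)) = inj₁ (trans p s , trans q r)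

  ≈ᵉ-map : {B : Set} (f : A → B) {x y : A × A} → x ≈ᵉ y → Prod.map f f x ≈ᵉ Prod.map f f y
  ≈ᵉ-map f (inj₁ (p , q)) = inj₁ (cong f p , cong f q)
  ≈ᵉ-map f (inj₂ (p , q)) = inj₂ (cong f p , cong f q)

  ≈ᵉ-injective : {B : Set} {f : A → B} → Injective _≡_ _≡_ f → {x y : A × A} →
                 Prod.map f f x ≈ᵉ Prod.map f f y → x ≈ᵉ y
  ≈ᵉ-injective f-inj (inj₁ (p , q)) = inj₁ (f-inj p , f-inj q)
  ≈ᵉ-injective f-inj (inj₂ (p , q)) = inj₂ (f-inj p , f-inj q)

  ≈ᵉ⇒MapsInto : {x y : A × A} → x ≈ᵉ y → MapsInto id x y
  ≈ᵉ⇒MapsInto (inj₁ (refl , refl)) = maps first second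
  ≈ᵉ⇒MapsInto (inj₂ (refl , refl)) = maps second first

MapsInto-endpoint : {A B : Set} {h : A → B} {x : A × A} {y : B × B} {u : A} →
                    MapsInto h x y → Endpoint u x → Endpoint (h u) y
MapsInto-endpoint (maps p _) first = p
MapsInto-endpoint (maps _ q) second = q

MapsInto-∘ : {A B C : Set} {g : A → B} {h : B → C} {x : A × A} {y : B × B} {z : C × C} →
             MapsInto h y z → MapsInto g x y → MapsInto (h ∘ g) x z
MapsInto-∘ hyz (maps p q) = maps (MapsInto-endpoint hyz p) (MapsInto-endpoint hyz q)

Endpoint-map⁻ : {A B : Set} {f : A → B} {x : A × A} {v : B} →
                Endpoint v (Prod.map f f x) → ∃ λ u → Endpoint u x × f u ≡ v
Endpoint-map⁻ first = _ , first , refl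
Endpoint-map⁻ second = _ , second , refl

disjointᵇ-sound : {x y : Fin m × Fin m} {u : Fin m} → disjointᵇ x y ≡ true → Endpoint u x → Endpoint u y → ⊥
disjointᵇ-sound {x = a , b} {c , d} eq ux uy with a ≟ c | a ≟ d | b ≟ c | b ≟ d
disjointᵇ-sound () _ _ | yes _ | _ | _ | _
disjointᵇ-sound () _ _ | no _ | yes _ | _ | _
disjointᵇ-sound () _ _ | no _ | no _ | yes _ | _
disjointᵇ-sound () _ _ | no _ | no _ | no _ | yes _
disjointᵇ-sound _ first first | no a≢c | _ | _ | _ = a≢c refl
disjointᵇ-sound _ first second | no _ | no a≢d | _ | _ = a≢d refl
disjointᵇ-sound _ second first | no _ | no _ | no b≢c | _ = b≢c refl
disjointᵇ-sound _ second second | no _ | no _ | no _ | no b≢d = b≢d refl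

disjointᵇ-complete : {x y : Fin m × Fin m} → (∀ {u} → Endpoint u x → Endpoint u y → ⊥) → disjointᵇ x y ≡ true
disjointᵇ-complete {x = a , b} {c , d} apart with a ≟ c | a ≟ d | b ≟ c | b ≟ d
... | yes refl | _ | _ | _ = ⊥-elim (apart first first)
... | no _ | yes refl | _ | _ = ⊥-elim (apart first second)
... | no _ | no _ | yes refl | _ = ⊥-elim (apart second first)
... | no _ | no _ | no _ | yes refl = ⊥-elim (apart second second)
... | no _ | no _ | no _ | no _ = refl

disjointᵇ-comm : (x y : Fin m × Fin m) → disjointᵇ x y ≡ disjointᵇ y x
disjointᵇ-comm x y = Bool.⇔→≡ {z = true} (mk⇔ (swap {x} {y}) (swap {y} {x}))
  where
  swap : ∀ {x y} → disjointᵇ x y ≡ true → disjointᵇ y x ≡ true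
  swap {x} {y} d = disjointᵇ-complete {x = y} {y = x} λ uy ux → disjointᵇ-sound {x = x} {y = y} d ux uy

-- A common end of x′ and y′ would be carried by h to a common end of x and y.
disjointᵇ-reflect : {a b : ℕ} {h : Fin a → Fin b} {x y : Fin b × Fin b} {x′ y′ : Fin a × Fin a} →
  MapsInto h x′ x → MapsInto h y′ y → disjointᵇ x y ≡ true → disjointᵇ x′ y′ ≡ true
disjointᵇ-reflect {x = x} {y} {x′} {y′} hx hy d = disjointᵇ-complete {x = x′} {y = y′}
  λ ux uy → disjointᵇ-sound {x = x} {y = y} d (MapsInto-endpoint hx ux) (MapsInto-endpoint hy uy)

disjointᵇ-injective : {a b : ℕ} {f : Fin a → Fin b} → Injective _≡_ _≡_ f → {x y : Fin a × Fin a} →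
  disjointᵇ x y ≡ true → disjointᵇ (Prod.map f f x) (Prod.map f f y) ≡ true
disjointᵇ-injective {f = f} f-inj {x} {y} d = disjointᵇ-complete {x = Prod.map f f x} {y = Prod.map f f y} apart
  where
  apart : ∀ {v} → Endpoint v (Prod.map f f x) → Endpoint v (Prod.map f f y) → ⊥
  apart p q with Endpoint-map⁻ {f = f} p | Endpoint-map⁻ {f = f} q
  ... | _ , u∈x , refl | _ , u′∈y , fu′≡fu = disjointᵇ-sound d u∈x (subst (λ w → Endpoint w y) (f-inj fu′≡fu) u′∈y)

Ordered : Fin m × Fin m → Set
Ordered x = toℕ (proj₁ x) < toℕ (proj₂ x)

ord : Fin m → Fin m → Fin m × Fin m
ord a b = if toℕ a <ᵇ toℕ b then (a , b) else (b , a)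

ord-≈ᵉ : (a b : Fin m) → ord a b ≈ᵉ (a , b)
ord-≈ᵉ a b with toℕ a <ᵇ toℕ b
... | true = inj₁ (refl , refl)
... | false = inj₂ (refl , refl)

ord-ordered : {a b : Fin m} → a ≢ b → Ordered (ord a b)
ord-ordered {a = a} {b} a≢b with toℕ a <ᵇ toℕ b in lt
... | true = ℕ.<ᵇ⇒< (toℕ a) (toℕ b) (subst T (sym lt) _)
... | false with ℕ.<-cmp (toℕ a) (toℕ b)
...   | tri< a<b _ _ = ⊥-elim (subst T lt (ℕ.<⇒<ᵇ a<b))
...   | tri≈ _ a≡b _ = ⊥-elim (a≢b (toℕ-injective a≡b))
...   | tri> _ _ b<a = b<a

ordered-≈ᵉ : {x y : Fin m × Fin m} → Ordered x → Ordered y → x ≈ᵉ y → x ≡ y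
ordered-≈ᵉ _ _ (inj₁ (refl , refl)) = refl
ordered-≈ᵉ x< y< (inj₂ (refl , refl)) = ⊥-elim (ℕ.<-asym x< y<)

module _ {A : Set} where

  lookup-injective : {xs : List A} → Unique xs → Injective _≡_ _≡_ (lookup xs)
  lookup-injective {x ∷ xs} _ {zero} {zero} _ = refl
  lookup-injective {x ∷ xs} (x∉xs ∷ _) {zero} {suc j} eq = ⊥-elim (All.lookup x∉xs (∈-lookup j) eq)
  lookup-injective {x ∷ xs} (x∉xs ∷ _) {suc i} {zero} eq = ⊥-elim (All.lookup x∉xs (∈-lookup i) (sym eq))
  lookup-injective {x ∷ xs} (_ ∷ u) {suc i} {suc j} eq = cong suc (lookup-injective u eq)

  module _ {xs ys : List A} (xs⊆ys : ∀ {x} → x ∈ xs → x ∈ ys) where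

    reindex : Fin (length xs) → Fin (length ys)
    reindex i = index (xs⊆ys (∈-lookup i))

    lookup-reindex : ∀ i → lookup ys (reindex i) ≡ lookup xs i
    lookup-reindex i = sym (lookup-index (xs⊆ys (∈-lookup i)))

    reindex-injective : Unique xs → Injective _≡_ _≡_ reindex
    reindex-injective u {i} {j} eq =
      lookup-injective u (trans (sym (lookup-reindex i)) (trans (cong (lookup ys) eq) (lookup-reindex j)))

    length-mono : Unique xs → length xs ≤ length ys
    length-mono u = injective⇒≤ (reindex-injective u)

module _ (G : Graph) where

  private
    edgeᵇ : Fin (n G) × Fin (n G) → Bool
    edgeᵇ e = (toℕ (proj₁ e) <ᵇ toℕ (proj₂ e)) ∧ adj G (proj₁ e) (proj₂ e)

    vertexPairs : List (Fin (n G) × Fin (n G))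
    vertexPairs = cartesianProduct (allFin (n G)) (allFin (n G))

  ∈-edges⁻ : {e : Fin (n G) × Fin (n G)} → e ∈ edges G → Ordered e × adj G (proj₁ e) (proj₂ e) ≡ true
  ∈-edges⁻ {a , b} e∈ with toℕ a <ᵇ toℕ b in lt | adj G a b | proj₂ (∈-filter⁻ (T? ∘ edgeᵇ) {xs = vertexPairs} e∈)
  ... | true | true | _ = ℕ.<ᵇ⇒< (toℕ a) (toℕ b) (subst T (sym lt) _) , refl

  ∈-edges⁺ : {a b : Fin (n G)} → Ordered (a , b) → adj G a b ≡ true → (a , b) ∈ edges G
  ∈-edges⁺ {a} {b} a<b ab = ∈-filter⁺ (T? ∘ edgeᵇ) (∈-cartesianProduct⁺ (∈-allFin a) (∈-allFin b))
    (Equivalence.from Bool.T-∧ (ℕ.<⇒<ᵇ a<b , Equivalence.from Bool.T-≡ ab))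

  edges-unique : Unique (edges G)
  edges-unique = filter⁺ (T? ∘ edgeᵇ) (cartesianProduct⁺ (allFin⁺ (n G)) (allFin⁺ (n G)))

  ord-∈-edges : Symmetric G → {a b : Fin (n G)} → a ≢ b → adj G a b ≡ true → ord a b ∈ edges G
  ord-∈-edges sym-G {a} {b} a≢b ab with ord a b | ord-≈ᵉ a b | ord-ordered a≢b
  ... | _ | inj₁ (refl , refl) | lt = ∈-edges⁺ lt ab
  ... | _ | inj₂ (refl , refl) | lt = ∈-edges⁺ lt (trans (sym-G b a) ab)

-- Jump graphs on lists of pairs and monotonicity of J

-- J G is JOn (edges G) by definition.
JOn : List (Fin m × Fin m) → Graph
JOn L = mkGraph (length L) (λ i j → disjointᵇ (lookup L i) (lookup L j))

JOn-symmetric : (L : List (Fin m × Fin m)) → Symmetric (JOn L)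
JOn-symmetric L i j = disjointᵇ-comm (lookup L i) (lookup L j)

JOn-reflect : {a b : ℕ} {L : List (Fin a × Fin a)} {M : List (Fin b × Fin b)} (h : Fin a → Fin b)
  (σ : Fin (length M) → Fin (length L)) → Injective _≡_ _≡_ σ →
  (∀ i → MapsInto h (lookup L (σ i)) (lookup M i)) → SubgraphOf (JOn M) (JOn L)
JOn-reflect h σ σ-inj into = σ , σ-inj , λ i j → disjointᵇ-reflect (into i) (into j)

JOn-⊆ : {L M : List (Fin m × Fin m)} → Unique L → (∀ {x} → x ∈ L → x ∈ M) → SubgraphOf (JOn L) (JOn M)
JOn-⊆ {L = L} {M} u L⊆M = JOn-reflect {L = M} {M = L} id (reindex L⊆M) (reindex-injective L⊆M u)
  λ i → ≈ᵉ⇒MapsInto (inj₁ (cong proj₁ (lookup-reindex L⊆M i) , cong proj₂ (lookup-reindex L⊆M i)))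

⊆-trans : {A B C : Graph} → SubgraphOf A B → SubgraphOf B C → SubgraphOf A C
⊆-trans (f , f-inj , f-adj) (g , g-inj , g-adj) = g ∘ f , f-inj ∘ g-inj , λ a b → g-adj _ _ ∘ f-adj a b

⊆-size : {A B : Graph} → SubgraphOf A B → n A ≤ n B
⊆-size (_ , f-inj , _) = injective⇒≤ f-inj

J-mono : {A B : Graph} → Symmetric B → SubgraphOf A B → SubgraphOf (J A) (J B)
J-mono {A} {B} sym-B (f , f-inj , f-adj) = σ , σ-inj , σ-adj
  where
  image : Fin (n A) × Fin (n A) → Fin (n B) × Fin (n B)
  image e = ord (f (proj₁ e)) (f (proj₂ e))

  image-≈ᵉ : ∀ e → image e ≈ᵉ Prod.map f f e
  image-≈ᵉ e = ord-≈ᵉ (f (proj₁ e)) (f (proj₂ e))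

  image∈ : ∀ {e} → e ∈ edges A → image e ∈ edges B
  image∈ e∈ with ∈-edges⁻ A e∈
  ... | lt , ab = ord-∈-edges B sym-B (ℕ.<⇒≢ lt ∘ cong toℕ ∘ f-inj) (f-adj _ _ ab)

  σ : Fin (n (J A)) → Fin (n (J B))
  σ i = index (image∈ (∈-lookup i))

  lookup-σ : ∀ i → lookup (edges B) (σ i) ≡ image (lookup (edges A) i)
  lookup-σ i = sym (lookup-index (image∈ (∈-lookup i)))

  σ-inj : Injective _≡_ _≡_ σ
  σ-inj {i} {j} eq = lookup-injective (edges-unique A)
    (ordered-≈ᵉ (proj₁ (∈-edges⁻ A (∈-lookup i))) (proj₁ (∈-edges⁻ A (∈-lookup j)))
      (≈ᵉ-injective f-inj (≈ᵉ-trans (≈ᵉ-sym (image-≈ᵉ x)) (subst (_≈ᵉ Prod.map f f y) (sym same) (image-≈ᵉ y)))))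
    where
    x = lookup (edges A) i
    y = lookup (edges A) j
    same : image x ≡ image y
    same = trans (sym (lookup-σ i)) (trans (cong (lookup (edges B)) eq) (lookup-σ j))

  σ-adj : ∀ i j → adj (J A) i j ≡ true → adj (J B) (σ i) (σ j) ≡ true
  σ-adj i j d = subst₂ (λ x y → disjointᵇ x y ≡ true) (sym (lookup-σ i)) (sym (lookup-σ j))
    (disjointᵇ-reflect (≈ᵉ⇒MapsInto (image-≈ᵉ _)) (≈ᵉ⇒MapsInto (image-≈ᵉ _)) (disjointᵇ-injective f-inj d))

J^-symmetric : {G : Graph} → Symmetric G → ∀ k → Symmetric (J^ k G)
J^-symmetric sym-G zero = sym-G
J^-symmetric {G} sym-G (suc k) = JOn-symmetric (edges (J^ k G))

J^-mono : {A B : Graph} → Symmetric B → SubgraphOf A B → ∀ k → SubgraphOf (J^ k A) (J^ k B)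
J^-mono sym-B sub zero = sub
J^-mono sym-B sub (suc k) = J-mono (J^-symmetric sym-B k) (J^-mono sym-B sub k)

J^-suc : ∀ k G → J^ k (J G) ≡ J^ (suc k) G
J^-suc zero G = refl
J^-suc (suc k) G = cong J (J^-suc k G)

J^-+ : ∀ j k G → J^ j (J^ k G) ≡ J^ (j + k) G
J^-+ zero k G = refl
J^-+ (suc j) k G = cong J (J^-+ j k G)

-- Dissipation and accumulation under embeddings

Dissipates : Graph → Set
Dissipates G = ∃[ k ] n (J^ k G) ≡ 0

dissipates-under : {G K : Graph} → Symmetric K → SubgraphOf (J G) K → Dissipates K → Dissipates G
dissipates-under {G} {K} sym-K sub (k , empty) = suc k , ℕ.n≤0⇒n≡0
  (subst (λ X → n X ≤ 0) (J^-suc k G) (subst (_ ≤_) empty (⊆-size {J^ k (J G)} {J^ k K} (J^-mono {J G} sym-K sub k))))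

accumulates-over : {G K : Graph} → SubgraphOf K (J G) → AccumulatesC5orNet K → AccumulatesC5orNet G
accumulates-over {G} {K} sub (k , found) = suc k , Sum.map lift lift found
  where
  lift : {H : Graph} → SubgraphOf H (J^ k K) → SubgraphOf H (J^ (suc k) G)
  lift {H} h = subst (SubgraphOf H) (J^-suc k G)
    (⊆-trans {H} {J^ k K} {J^ k (J G)} h (J^-mono {K} {J G} (JOn-symmetric (edges G)) sub k))

persists : {H G : Graph} → SubgraphOf H (J H) → Symmetric G → SubgraphOf H G → ∀ k → SubgraphOf H (J^ k G)
persists stable sym-G sub zero = sub
persists {H} {G} stable sym-G sub (suc k) =
  ⊆-trans {H} {J H} {J (J^ k G)} stable (J-mono {H} {J^ k G} (J^-symmetric sym-G k) (persists stable sym-G sub k))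

empty-persists : (G : Graph) → n G ≡ 0 → ∀ k → n (J^ k G) ≡ 0
empty-persists G empty zero = empty
empty-persists G empty (suc k) with J^ k G | empty-persists G empty k
... | mkGraph zero _ | refl = refl

stable-¬dissipates : {H G : Graph} → SubgraphOf H (J H) → 0 < n H → Symmetric G →
  ∀ {k} → SubgraphOf H (J^ k G) → ¬ Dissipates G
stable-¬dissipates {H} {G} stable nonempty sym-G {k} sub (j , empty) = ℕ.<⇒≢ nonempty
  (sym (ℕ.n≤0⇒n≡0 (subst (n H ≤_) never (⊆-size {H} {J^ j (J^ k G)} (persists stable (J^-symmetric sym-G k) sub j)))))
  where
  never : n (J^ j (J^ k G)) ≡ 0
  never = begin
    n (J^ j (J^ k G))  ≡⟨ cong n (J^-+ j k G) ⟩
    n (J^ (j + k) G)   ≡⟨ cong (λ i → n (J^ i G)) (ℕ.+-comm j k) ⟩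
    n (J^ (k + j) G)   ≡⟨ cong n (sym (J^-+ k j G)) ⟩
    n (J^ k (J^ j G))  ≡⟨ empty-persists (J^ j G) empty k ⟩
    0                  ∎
    where open ≡-Reasoning

-- Walks and shortest walks

module _ {G : Graph} where

  _++ʷ_ : {i j : ℕ} {s u t : Fin (n G)} → Walk G i s u → Walk G j u t → Walk G (i + j) s t
  here ++ʷ w = w
  step e v ++ʷ w = step e (v ++ʷ w)

  vertex : {d : ℕ} {s t : Fin (n G)} → Walk G d s t → Fin (suc d) → Fin (n G)
  vertex {s = s} _ zero = s
  vertex (step _ w) (suc p) = vertex w p

  prefix : {d : ℕ} {s t : Fin (n G)} (w : Walk G d s t) (p : Fin (suc d)) → Walk G (toℕ p) s (vertex w p)
  prefix _ zero = here
  prefix (step e w) (suc p) = step e (prefix w p)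

  suffix : {d : ℕ} {s t : Fin (n G)} (w : Walk G d s t) (p : Fin (suc d)) → Walk G (d ∸ toℕ p) (vertex w p) t
  suffix w zero = w
  suffix (step _ w) (suc p) = suffix w p

  vertex-adj : {d : ℕ} {s t : Fin (n G)} (w : Walk G d s t) (k : Fin d) →
               adj G (vertex w (inject₁ k)) (vertex w (suc k)) ≡ true
  vertex-adj (step e _) zero = e
  vertex-adj (step _ w) (suc k) = vertex-adj w k

  vertex-nonIsolated : Symmetric G → {d : ℕ} {s t : Fin (n G)} (w : Walk G (suc d) s t) →
                       ∀ p → NonIsolated G (vertex w p)
  vertex-nonIsolated sym-G w zero = vertex w (# 1) , vertex-adj w zero
  vertex-nonIsolated sym-G w (suc k) = vertex w (inject₁ k) , trans (sym-G _ _) (vertex-adj w k)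

  Shortest : {d : ℕ} {s t : Fin (n G)} → Walk G d s t → Set
  Shortest {d} {s} {t} _ = ∀ {j} → j < d → ¬ Walk G j s t

  module _ {d : ℕ} {s t : Fin (n G)} {w : Walk G d s t} (shortest : Shortest w) where

    shortest-bound : ∀ {ℓ} p q → Walk G ℓ (vertex w p) (vertex w q) → toℕ q ≤ toℕ p + ℓ
    shortest-bound {ℓ} p q u = ℕ.≮⇒≥ λ too-far → shortest (detour too-far) (prefix w p ++ʷ (u ++ʷ suffix w q))
      where
      detour : toℕ p + ℓ < toℕ q → toℕ p + (ℓ + (d ∸ toℕ q)) < d
      detour lt = begin-strict
        toℕ p + (ℓ + (d ∸ toℕ q))  ≡⟨ ℕ.+-assoc (toℕ p) ℓ _ ⟨
        toℕ p + ℓ + (d ∸ toℕ q)    <⟨ ℕ.+-monoˡ-< (d ∸ toℕ q) lt ⟩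
        toℕ q + (d ∸ toℕ q)        ≡⟨ ℕ.m+[n∸m]≡n (toℕ≤pred[n] q) ⟩
        d                          ∎
        where open ℕ.≤-Reasoning

    shortest-injective : Injective _≡_ _≡_ (vertex w)
    shortest-injective {p} {q} eq = toℕ-injective (ℕ.≤-antisym (bound p q (sym eq)) (bound q p eq))
      where
      bound : ∀ p q → vertex w q ≡ vertex w p → toℕ p ≤ toℕ q
      bound p q eq = subst (toℕ p ≤_) (ℕ.+-identityʳ (toℕ q)) (shortest-bound q p (subst (Walk G 0 (vertex w q)) eq here))

    shortest-adjacent : ∀ {p q} → adj G (vertex w p) (vertex w q) ≡ true → toℕ q ≤ suc (toℕ p)
    shortest-adjacent {p} {q} a = subst (toℕ q ≤_) (ℕ.+-comm (toℕ p) 1) (shortest-bound p q (step a here))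

diameter-geodesic : {G : Graph} {d : ℕ} → HasDiameter G (suc d) → ∃₂ λ s t → Σ (Walk G (suc d) s t) Shortest
diameter-geodesic (within , s , t , s-nonIsolated , t-nonIsolated , far)
  with within s t s-nonIsolated t-nonIsolated
... | j , j≤1+d , w with ℕ.≤-antisym j≤1+d (ℕ.≰⇒> λ j≤d → far (j , j≤d , w))
...   | refl = s , t , w , λ j<1+d w′ → far (_ , ℕ.≤-pred j<1+d , w′)

pathStep : {d : ℕ} → Fin d → Fin (suc d) × Fin (suc d)
pathStep k = inject₁ k , suc k

inject₁≢suc : {d : ℕ} (k : Fin d) → inject₁ k ≢ suc k
inject₁≢suc k eq = ℕ.1+n≢n (trans (sym (cong toℕ eq)) (toℕ-inject₁ k))

pathStep-injective : {d : ℕ} {k l : Fin d} → pathStep k ≈ᵉ pathStep l → k ≡ l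
pathStep-injective (inj₁ (p , _)) = inject₁-injective p
pathStep-injective {k = k} {l} (inj₂ (p , q)) = ⊥-elim (ℕ.<-asym {toℕ k} {toℕ l} k<l l<k)
  where
  k<l : toℕ k < toℕ l
  k<l = ℕ.≤-reflexive (trans (cong toℕ q) (toℕ-inject₁ l))
  l<k : toℕ l < toℕ k
  l<k = ℕ.≤-reflexive (trans (sym (cong toℕ p)) (toℕ-inject₁ k))

successor : {d : ℕ} (p q : Fin (suc d)) → toℕ q ≡ suc (toℕ p) → ∃ λ k → p ≡ inject₁ k × q ≡ suc k
successor p (suc k) eq = k , toℕ-injective (trans (ℕ.suc-injective (sym eq)) (sym (toℕ-inject₁ k))) , refl

consecutive : {d : ℕ} (p q : Fin (suc d)) → toℕ q ≤ suc (toℕ p) → toℕ p ≤ suc (toℕ q) → p ≢ q →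
              ∃ λ k → (p , q) ≈ᵉ pathStep k
consecutive p q q≤ p≤ p≢q with ℕ.<-cmp (toℕ p) (toℕ q)
... | tri< p<q _ _ with successor p q (ℕ.≤-antisym q≤ p<q)
...   | k , refl , refl = k , inj₁ (refl , refl)
consecutive p q q≤ p≤ p≢q | tri≈ _ eq _ = ⊥-elim (p≢q (toℕ-injective eq))
consecutive p q q≤ p≤ p≢q | tri> _ _ q<p with successor q p (ℕ.≤-antisym p≤ q<p)
...   | k , refl , refl = k , inj₂ (refl , refl)

-- Distances along lazy homomorphisms

LazyHomomorphism : (G K : Graph) → (Fin (n G) → Fin (n K)) → Set
LazyHomomorphism G K g = ∀ u v → adj G u v ≡ true → adj K (g u) (g v) ≡ true ⊎ g u ≡ g v

walk-image : {G K : Graph} {g : Fin (n G) → Fin (n K)} → LazyHomomorphism G K g →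
  ∀ {j s t} → Walk G j s t → DistLe K j (g s) (g t)
walk-image hom here = 0 , z≤n , here
walk-image {K = K} {g = g} hom {t = t} (step e rest) with walk-image hom rest | hom _ _ e
... | i , i≤j , v | inj₁ a = suc i , s≤s i≤j , step a v
... | i , i≤j , v | inj₂ eq = i , ℕ.m≤n⇒m≤1+n i≤j , subst (λ x → Walk K i x (g t)) (sym eq) v

DistLe-image : {G K : Graph} {g : Fin (n G) → Fin (n K)} → LazyHomomorphism G K g →
  ∀ {j s t} → DistLe G j s t → DistLe K j (g s) (g t)
DistLe-image hom (_ , i≤j , w) = Prod.map₂ (Prod.map₁ (λ i′≤i → ℕ.≤-trans i′≤i i≤j)) (walk-image hom w)

withinᵇ : (K : Graph) → ℕ → Fin (n K) → Fin (n K) → Bool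
withinᵇ K zero s t = does (s ≟ t)
withinᵇ K (suc j) s t = does (s ≟ t) ∨ does (any? λ w → T? (adj K s w ∧ withinᵇ K j w t))

walk⇒withinᵇ : {K : Graph} {i j : ℕ} {s t : Fin (n K)} → Walk K i s t → i ≤ j → withinᵇ K j s t ≡ true
walk⇒withinᵇ {j = zero} {s} here _ = dec-true (s ≟ s) refl
walk⇒withinᵇ {K} {j = suc j} {s} here _ =
  cong (_∨ does (any? λ w → T? (adj K s w ∧ withinᵇ K j w s))) (dec-true (s ≟ s) refl)
walk⇒withinᵇ {K} {j = suc j} {s} {t} (step {w = v} e rest) (s≤s i≤j) = trans
  (cong (does (s ≟ t) ∨_) (dec-true (any? _)
    (v , Equivalence.from Bool.T-∧ (Equivalence.from Bool.T-≡ e , Equivalence.from Bool.T-≡ (walk⇒withinᵇ rest i≤j)))))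
  (Bool.∨-zeroʳ _)

DistLe⇒withinᵇ : {K : Graph} {j : ℕ} {s t : Fin (n K)} → DistLe K j s t → withinᵇ K j s t ≡ true
DistLe⇒withinᵇ (_ , i≤j , w) = walk⇒withinᵇ w i≤j

graphOf : List (Fin m × Fin m) → Graph
graphOf {m} L = mkGraph m λ u v →
  does (Any.any? (λ y → ((u ≟ proj₁ y) ×-dec (v ≟ proj₂ y)) ⊎-dec ((u ≟ proj₂ y) ×-dec (v ≟ proj₁ y))) L)

graphOf-adj : {L : List (Fin m × Fin m)} {y : Fin m × Fin m} {u v : Fin m} →
              y ∈ L → (u , v) ≈ᵉ y → adj (graphOf L) u v ≡ true
graphOf-adj {L = L} y∈L uv≈y = dec-true (Any.any? _ L) (Any.map (λ { refl → uv≈y }) y∈L)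

graphOf-lazy : {L : List (Fin m × Fin m)} {y : Fin m × Fin m} {u v : Fin m} →
               y ∈ L → Endpoint u y → Endpoint v y → adj (graphOf L) u v ≡ true ⊎ u ≡ v
graphOf-lazy y∈L first first = inj₂ refl
graphOf-lazy y∈L first second = inj₁ (graphOf-adj y∈L (inj₁ (refl , refl)))
graphOf-lazy y∈L second first = inj₁ (graphOf-adj y∈L (inj₂ (refl , refl)))
graphOf-lazy y∈L second second = inj₂ refl

lazyHomomorphism : {G : Graph} {L : List (Fin m × Fin m)} (g : Fin (n G) → Fin m) → IsSimple G →
  (∀ {e} → e ∈ edges G → ∃ λ y → y ∈ L × MapsInto g e y) → LazyHomomorphism G (graphOf L) g
lazyHomomorphism {G = G} g simple carried u v uv
  with carried (ord-∈-edges G (proj₁ simple) (adjacent⇒distinct simple uv) uv)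
... | y , y∈L , g-ord = graphOf-lazy y∈L (MapsInto.into₁ g-uv) (MapsInto.into₂ g-uv)
  where
  g-uv : MapsInto g (u , v) y
  g-uv = MapsInto-∘ g-ord (≈ᵉ⇒MapsInto (≈ᵉ-sym (ord-≈ᵉ u v)))

-- Small graphs checked by computation

embedding? : (H K : Graph) (f : Fin (n H) → Fin (n K)) →
  Dec (∀ a b → (f a ≡ f b → a ≡ b) × (adj H a b ≡ true → adj K (f a) (f b) ≡ true))
embedding? H K f = all? λ a → all? λ b →
  (f a ≟ f b →-dec a ≟ b) ×-dec (adj H a b Bool.≟ true →-dec adj K (f a) (f b) Bool.≟ true)

embeds : (H K : Graph) (f : Fin (n H) → Fin (n K)) → True (embedding? H K f) → SubgraphOf H K
embeds H K f ok = f , (λ {a} {b} → proj₁ (toWitness ok a b)) , λ a b → proj₂ (toWitness ok a b)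

C5-stable : SubgraphOf C5 (J C5)
C5-stable = embeds C5 (J C5) (Vec.lookup (# 0 ∷ # 3 ∷ # 1 ∷ # 2 ∷ # 4 ∷ [])) _

Net-stable : SubgraphOf Net (J Net)
Net-stable = embeds Net (J Net) (Vec.lookup (# 2 ∷ # 4 ∷ # 5 ∷ # 3 ∷ # 1 ∷ # 0 ∷ [])) _

accumulates⇒infinite : {G : Graph} → Symmetric G → AccumulatesC5orNet G → DissipationInfinite G
accumulates⇒infinite sym-G (k , inj₁ C5⊆) = stable-¬dissipates C5-stable (s≤s z≤n) sym-G {k} C5⊆
accumulates⇒infinite sym-G (k , inj₂ Net⊆) = stable-¬dissipates Net-stable (s≤s z≤n) sym-G {k} Net⊆

C5-at : {G : Graph} (k : ℕ) (f : Fin 5 → Fin (n (J^ k G))) → True (embedding? C5 (J^ k G) f) →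
  AccumulatesC5orNet G
C5-at {G} k f ok = k , inj₁ (embeds C5 (J^ k G) f ok)

-- Model vertices 0, …, 4 stand for the geodesic, and offPath for everything else.
modelStep : Fin 4 → Fin 6 × Fin 6
modelStep k = Prod.map inject₁ inject₁ (pathStep k)

offPath : Fin 6
offPath = fromℕ 5

pathModel : List (Fin 6 × Fin 6)
pathModel = tabulate modelStep

pendantAt : Fin 6 → Fin 6 × Fin 6
pendantAt q = q , offPath

onePendant : Fin 6 → List (Fin 6 × Fin 6)
onePendant q = pathModel ++ pendantAt q ∷ []

inner : Fin 3 → Fin 6
inner s = suc (inject₁ (inject₁ s))

twoPendants : Fin 3 → Fin 3 → List (Fin 6 × Fin 6)
twoPendants s t = pathModel ++ pendantAt (inner s) ∷ pendantAt (inner t) ∷ []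

-- Moving the ends of a pendant edge inwards (v₀ ↦ v₁, v₄ ↦ v₃) shrinks its set
-- of disjoint path edges to one of three minimal ones.
collapse : Fin 6 → Fin 6
collapse zero = # 1
collapse (suc zero) = # 1
collapse (suc (suc zero)) = # 2
collapse (suc (suc (suc zero))) = # 3
collapse (suc (suc (suc (suc zero)))) = # 3
collapse (suc (suc (suc (suc (suc zero))))) = # 5

collapse-modelStep : ∀ k → MapsInto collapse (modelStep k) (modelStep k)
collapse-modelStep zero = maps second second
collapse-modelStep (suc zero) = maps first second
collapse-modelStep (suc (suc zero)) = maps first second
collapse-modelStep (suc (suc (suc zero))) = maps first first

collapse-anchored : ∀ q → ∃ λ s → Endpoint (collapse q) (pendantAt (inner s))
collapse-anchored zero = # 0 , first
collapse-anchored (suc zero) = # 0 , first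
collapse-anchored (suc (suc zero)) = # 1 , first
collapse-anchored (suc (suc (suc zero))) = # 2 , first
collapse-anchored (suc (suc (suc (suc zero)))) = # 2 , first
collapse-anchored (suc (suc (suc (suc (suc zero))))) = # 0 , second

twoPendants-accumulate : ∀ s t → AccumulatesC5orNet (JOn (twoPendants s t))
twoPendants-accumulate zero zero = C5-at 2 (Vec.lookup (# 0 ∷ # 3 ∷ # 1 ∷ # 4 ∷ # 7 ∷ [])) _
twoPendants-accumulate zero (suc zero) = C5-at 0 (Vec.lookup (# 0 ∷ # 2 ∷ # 4 ∷ # 3 ∷ # 5 ∷ [])) _
twoPendants-accumulate zero (suc (suc zero)) = C5-at 1 (Vec.lookup (# 0 ∷ # 3 ∷ # 2 ∷ # 5 ∷ # 4 ∷ [])) _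
twoPendants-accumulate (suc zero) zero = C5-at 0 (Vec.lookup (# 0 ∷ # 2 ∷ # 5 ∷ # 3 ∷ # 4 ∷ [])) _
twoPendants-accumulate (suc zero) (suc zero) = C5-at 2 (Vec.lookup (# 0 ∷ # 4 ∷ # 1 ∷ # 3 ∷ # 6 ∷ [])) _
twoPendants-accumulate (suc zero) (suc (suc zero)) = C5-at 0 (Vec.lookup (# 0 ∷ # 4 ∷ # 3 ∷ # 1 ∷ # 5 ∷ [])) _
twoPendants-accumulate (suc (suc zero)) zero = C5-at 1 (Vec.lookup (# 0 ∷ # 3 ∷ # 2 ∷ # 5 ∷ # 4 ∷ [])) _
twoPendants-accumulate (suc (suc zero)) (suc zero) = C5-at 0 (Vec.lookup (# 0 ∷ # 4 ∷ # 1 ∷ # 3 ∷ # 5 ∷ [])) _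
twoPendants-accumulate (suc (suc zero)) (suc (suc zero)) = C5-at 2 (Vec.lookup (# 0 ∷ # 3 ∷ # 2 ∷ # 5 ∷ # 4 ∷ [])) _

pathModel-dissipates : Dissipates (JOn pathModel)
pathModel-dissipates = 3 , refl

-- At offPath the pendant pair is a loop, i.e. an edge detached from the path.
onePendant-dichotomy : ∀ q → (q ≢ offPath × Dissipates (JOn (onePendant q))) ⊎
                             ∃ λ p → withinᵇ (graphOf (onePendant q)) 4 offPath (inject₁ p) ≡ false
onePendant-dichotomy zero = inj₂ (# 4 , refl)
onePendant-dichotomy (suc zero) = inj₁ ((λ ()) , 5 , refl)
onePendant-dichotomy (suc (suc zero)) = inj₁ ((λ ()) , 4 , refl)
onePendant-dichotomy (suc (suc (suc zero))) = inj₁ ((λ ()) , 5 , refl)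
onePendant-dichotomy (suc (suc (suc (suc zero)))) = inj₂ (# 0 , refl)
onePendant-dichotomy (suc (suc (suc (suc (suc zero))))) = inj₂ (# 0 , refl)

-- Graphs of diameter 4

module Diameter4 (G : Graph) (simple : IsSimple G)
  (within : ∀ u v → NonIsolated G u → NonIsolated G v → DistLe G 4 u v)
  {s t : Fin (n G)} (path : Walk G 4 s t) (shortest : Shortest path) where

  open import Data.List.Membership.DecPropositional (≡-dec (_≟_ {n G}) (_≟_ {n G})) using (_∈?_)

  Pair : Set
  Pair = Fin (n G) × Fin (n G)

  sym-G : Symmetric G
  sym-G = proj₁ simple

  V : Fin 5 → Fin (n G)
  V = vertex path

  V-injective : Injective _≡_ _≡_ V
  V-injective = shortest-injective shortest

  pathEdge : Fin 4 → Pair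
  pathEdge k = ord (V (inject₁ k)) (V (suc k))

  pathEdge-≈ᵉ : ∀ k → pathEdge k ≈ᵉ Prod.map V V (pathStep k)
  pathEdge-≈ᵉ k = ord-≈ᵉ (V (inject₁ k)) (V (suc k))

  pathEdge-ordered : ∀ k → Ordered (pathEdge k)
  pathEdge-ordered k = ord-ordered (inject₁≢suc k ∘ V-injective)

  pathEdge∈ : ∀ k → pathEdge k ∈ edges G
  pathEdge∈ k = ord-∈-edges G sym-G (inject₁≢suc k ∘ V-injective) (vertex-adj path k)

  pathEdges : List Pair
  pathEdges = tabulate pathEdge

  pathEdges⊆edges : ∀ {e} → e ∈ pathEdges → e ∈ edges G
  pathEdges⊆edges e∈P with ∈-tabulate⁻ {f = pathEdge} e∈P
  ... | k , refl = pathEdge∈ k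

  pathEdges-unique : Unique pathEdges
  pathEdges-unique = tabulate⁺ λ {k} {l} eq → pathStep-injective (≈ᵉ-injective V-injective
    (≈ᵉ-trans (≈ᵉ-sym (pathEdge-≈ᵉ k)) (subst (_≈ᵉ Prod.map V V (pathStep l)) (sym eq) (pathEdge-≈ᵉ l))))

  OnPath : Fin (n G) → Set
  OnPath u = ∃ λ p → V p ≡ u

  onPath? : ∀ u → Dec (OnPath u)
  onPath? u = any? λ p → V p ≟ u

  position : Fin (n G) → Fin 6
  position u with onPath? u
  ... | yes (p , _) = inject₁ p
  ... | no _ = offPath

  position-V : ∀ p → position (V p) ≡ inject₁ p
  position-V p with onPath? (V p)
  ... | yes (q , Vq≡Vp) = cong inject₁ (V-injective Vq≡Vp)
  ... | no off = ⊥-elim (off (p , refl))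

  position-off : ∀ {u} → ¬ OnPath u → position u ≡ offPath
  position-off {u} off with onPath? u
  ... | yes on = ⊥-elim (off on)
  ... | no _ = refl

  position-pathEdge : ∀ k → MapsInto position (pathEdge k) (modelStep k)
  position-pathEdge k = MapsInto-∘
    (maps (subst (λ q → Endpoint q (modelStep k)) (sym (position-V (inject₁ k))) first)
          (subst (λ q → Endpoint q (modelStep k)) (sym (position-V (suc k))) second))
    (≈ᵉ⇒MapsInto (pathEdge-≈ᵉ k))

  extraEdges : List Pair
  extraEdges = filter (λ e → ¬? (e ∈? pathEdges)) (edges G)

  extra⁻ : ∀ {e} → e ∈ extraEdges → e ∈ edges G × e ∉ pathEdges
  extra⁻ = ∈-filter⁻ (λ e → ¬? (e ∈? pathEdges)) {xs = edges G}

  extraEdges-unique : Unique extraEdges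
  extraEdges-unique = filter⁺ (λ e → ¬? (e ∈? pathEdges)) (edges-unique G)

  edges-split : ∀ {e} → e ∈ edges G → e ∈ pathEdges ++ extraEdges
  edges-split {e} e∈E with e ∈? pathEdges
  ... | yes e∈P = ∈-++⁺ˡ e∈P
  ... | no e∉P = ∈-++⁺ʳ pathEdges (∈-filter⁺ (λ e → ¬? (e ∈? pathEdges)) e∈E e∉P)

  edgeCount-extra : edgeCount G ≡ 4 + length extraEdges
  edgeCount-extra = ℕ.≤-antisym
    (subst (edgeCount G ≤_) (length-++ pathEdges {extraEdges}) (length-mono edges-split (edges-unique G)))
    (subst (_≤ edgeCount G) (length-++ pathEdges {extraEdges}) (length-mono ⊆edges (++⁺ pathEdges-unique extraEdges-unique apart)))
    where
    apart : ∀ {e} → ¬ (e ∈ pathEdges × e ∈ extraEdges)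
    apart (e∈P , e∈R) = proj₂ (extra⁻ e∈R) e∈P
    ⊆edges : ∀ {e} → e ∈ pathEdges ++ extraEdges → e ∈ edges G
    ⊆edges = Sum.[ pathEdges⊆edges , proj₁ ∘ extra⁻ ] ∘ ∈-++⁻ pathEdges

  chord-is-pathEdge : ∀ {e} → e ∈ edges G → OnPath (proj₁ e) → OnPath (proj₂ e) → e ∈ pathEdges
  chord-is-pathEdge e∈E (p , refl) (q , refl) with ∈-edges⁻ G e∈E
  ... | e-ordered , Vp~Vq with consecutive p q (shortest-adjacent shortest Vp~Vq)
                                (shortest-adjacent shortest (trans (sym-G _ _) Vp~Vq)) (adjacent⇒distinct simple Vp~Vq ∘ cong V)
  ... | k , pq≈ = subst (_∈ pathEdges) (ordered-≈ᵉ (pathEdge-ordered k) e-ordered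
          (≈ᵉ-trans (pathEdge-≈ᵉ k) (≈ᵉ-sym (≈ᵉ-map V pq≈)))) (∈-tabulate⁺ {f = pathEdge} k)

  extra-hangs : ∀ {e} → e ∈ extraEdges → ∃₂ λ x w → ¬ OnPath w × e ≈ᵉ (x , w)
  extra-hangs {a , b} e∈R with extra⁻ e∈R | onPath? a | onPath? b
  ... | e∈E , e∉P | yes a-on | yes b-on = ⊥-elim (e∉P (chord-is-pathEdge e∈E a-on b-on))
  ... | _ | _ | no b-off = a , b , b-off , inj₁ (refl , refl)
  ... | _ | no a-off | yes _ = b , a , a-off , inj₂ (refl , refl)

  anchored : ∀ {e} → e ∈ extraEdges → ∃ λ s → MapsInto (collapse ∘ position) e (pendantAt (inner s))
  anchored e∈R with extra-hangs e∈R
  ... | x , w , w-off , e≈ with collapse-anchored (position x)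
  ...   | s , x↦ = s , MapsInto-∘ (maps x↦ w↦) (≈ᵉ⇒MapsInto e≈)
    where
    w↦ : Endpoint (collapse (position w)) (pendantAt (inner s))
    w↦ = subst (λ q → Endpoint (collapse q) (pendantAt (inner s))) (sym (position-off w-off)) second

  collapsed-pathEdge : ∀ k → MapsInto (collapse ∘ position) (pathEdge k) (modelStep k)
  collapsed-pathEdge k = MapsInto-∘ (collapse-modelStep k) (position-pathEdge k)

  accumulates-with-two-extra : ∀ {e f} → e ∈ extraEdges → f ∈ extraEdges → e ≢ f → AccumulatesC5orNet G
  accumulates-with-two-extra {e} {f} e∈R f∈R e≢f =
    accumulates-over (⊆-trans {JOn (twoPendants sᵉ sᶠ)} {JOn X} {J G} twoPendants⊆X X⊆J) (twoPendants-accumulate sᵉ sᶠ)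
    where
    sᵉ sᶠ : Fin 3
    sᵉ = proj₁ (anchored e∈R)
    sᶠ = proj₁ (anchored f∈R)

    X : List Pair
    X = pathEdges ++ e ∷ f ∷ []

    X-unique : Unique X
    X-unique = ++⁺ pathEdges-unique ((e≢f ∷ []) ∷ [] ∷ []) λ
      { (x∈P , here refl) → proj₂ (extra⁻ e∈R) x∈P
      ; (x∈P , there (here refl)) → proj₂ (extra⁻ f∈R) x∈P }

    extra⊆edges : ∀ {x} → x ∈ e ∷ f ∷ [] → x ∈ edges G
    extra⊆edges (here refl) = proj₁ (extra⁻ e∈R)
    extra⊆edges (there (here refl)) = proj₁ (extra⁻ f∈R)

    X⊆E : ∀ {x} → x ∈ X → x ∈ edges G
    X⊆E = Sum.[ pathEdges⊆edges , extra⊆edges ] ∘ ∈-++⁻ pathEdges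

    X⊆J : SubgraphOf (JOn X) (J G)
    X⊆J = JOn-⊆ X-unique X⊆E

    into : ∀ i → MapsInto (collapse ∘ position) (lookup X i) (lookup (twoPendants sᵉ sᶠ) i)
    into zero = collapsed-pathEdge zero
    into (suc zero) = collapsed-pathEdge (# 1)
    into (suc (suc zero)) = collapsed-pathEdge (# 2)
    into (suc (suc (suc zero))) = collapsed-pathEdge (# 3)
    into (suc (suc (suc (suc zero)))) = proj₂ (anchored e∈R)
    into (suc (suc (suc (suc (suc zero))))) = proj₂ (anchored f∈R)

    twoPendants⊆X : SubgraphOf (JOn (twoPendants sᵉ sᶠ)) (JOn X)
    twoPendants⊆X = JOn-reflect (collapse ∘ position) id id into

  unposition : Fin (n G) → Fin 6 → Fin (n G)
  unposition w = Vec.lookup (V (# 0) ∷ V (# 1) ∷ V (# 2) ∷ V (# 3) ∷ V (# 4) ∷ w ∷ [])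

  unposition-V : ∀ w p → unposition w (inject₁ p) ≡ V p
  unposition-V w zero = refl
  unposition-V w (suc zero) = refl
  unposition-V w (suc (suc zero)) = refl
  unposition-V w (suc (suc (suc zero))) = refl
  unposition-V w (suc (suc (suc (suc zero)))) = refl

  unposition-modelStep : ∀ w k → MapsInto (unposition w) (modelStep k) (pathEdge k)
  unposition-modelStep w k = MapsInto-∘ (≈ᵉ⇒MapsInto (≈ᵉ-sym (pathEdge-≈ᵉ k)))
    (maps (subst (λ u → Endpoint u (Prod.map V V (pathStep k))) (sym (unposition-V w (inject₁ k))) first)
          (subst (λ u → Endpoint u (Prod.map V V (pathStep k))) (sym (unposition-V w (suc k))) second))

  dissipates-without-extra : extraEdges ≡ [] → Dissipates G
  dissipates-without-extra R≡[] = dissipates-under (JOn-symmetric pathModel)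
    (⊆-trans {J G} {JOn (pathEdges ++ [])} {JOn pathModel} (JOn-⊆ (edges-unique G) cover)
      (JOn-reflect (unposition s) id id into))
    pathModel-dissipates
    where
    cover : ∀ {e} → e ∈ edges G → e ∈ pathEdges ++ []
    cover = subst (λ R → _ ∈ pathEdges ++ R) R≡[] ∘ edges-split
    into : ∀ i → MapsInto (unposition s) (lookup pathModel i) (lookup (pathEdges ++ []) i)
    into zero = unposition-modelStep s zero
    into (suc zero) = unposition-modelStep s (# 1)
    into (suc (suc zero)) = unposition-modelStep s (# 2)
    into (suc (suc (suc zero))) = unposition-modelStep s (# 3)

  module OneExtra {e : Pair} (R≡e : extraEdges ≡ e ∷ [])
                  (x w : Fin (n G)) (w-off : ¬ OnPath w) (e≈ : e ≈ᵉ (x , w)) where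

    cover : ∀ {e′} → e′ ∈ edges G → e′ ∈ pathEdges ++ e ∷ []
    cover = subst (λ R → _ ∈ pathEdges ++ R) R≡e ∘ edges-split

    e↦ : MapsInto position e (position x , offPath)
    e↦ = MapsInto-∘ (maps first (subst (λ q → Endpoint q (position x , offPath)) (sym (position-off w-off)) second))
                    (≈ᵉ⇒MapsInto e≈)

    carried : ∀ {e′} → e′ ∈ edges G → ∃ λ y → y ∈ onePendant (position x) × MapsInto position e′ y
    carried e′∈E with ∈-++⁻ pathEdges (cover e′∈E)
    ... | inj₁ e′∈P with ∈-tabulate⁻ {f = pathEdge} e′∈P
    ...   | k , refl = modelStep k , ∈-++⁺ˡ (∈-tabulate⁺ {f = modelStep} k) , position-pathEdge k
    carried e′∈E | inj₂ (here refl) = (position x , offPath) , ∈-++⁺ʳ pathModel (here refl) , e↦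

    w-nonIsolated : NonIsolated G w
    w-nonIsolated = neighbour e≈ (proj₂ (∈-edges⁻ G (proj₁ (extra⁻ (subst (e ∈_) (sym R≡e) (here refl))))))
      where
      neighbour : ∀ {e′} → e′ ≈ᵉ (x , w) → adj G (proj₁ e′) (proj₂ e′) ≡ true → NonIsolated G w
      neighbour (inj₁ (refl , refl)) x~w = x , trans (sym-G w x) x~w
      neighbour (inj₂ (refl , refl)) w~x = x , w~x

    model-distance : ∀ p → DistLe (graphOf (onePendant (position x))) 4 (position w) (position (V p))
    model-distance p = DistLe-image {K = graphOf (onePendant (position x))} (lazyHomomorphism position simple carried)
        (within w (V p) w-nonIsolated (vertex-nonIsolated sym-G path p))

    reaches-path : ∀ p → withinᵇ (graphOf (onePendant (position x))) 4 offPath (inject₁ p) ≡ true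
    reaches-path p = subst₂ (λ a b → withinᵇ (graphOf (onePendant (position x))) 4 a b ≡ true)
      (position-off w-off) (position-V p) (DistLe⇒withinᵇ {K = graphOf (onePendant (position x))} (model-distance p))

    unposition-e : ∀ {p} → V p ≡ x → MapsInto (unposition w) (inject₁ p , offPath) e
    unposition-e {p} refl = MapsInto-∘ (≈ᵉ⇒MapsInto (≈ᵉ-sym e≈))
      (maps (subst (λ u → Endpoint u (V p , w)) (sym (unposition-V w p)) first) second)

    via-onePendant : ∀ {p} → V p ≡ x → Dissipates (JOn (onePendant (inject₁ p))) → Dissipates G
    via-onePendant {p} Vp≡x = dissipates-under (JOn-symmetric (onePendant (inject₁ p)))
      (⊆-trans {J G} {JOn (pathEdges ++ e ∷ [])} {JOn (onePendant (inject₁ p))} (JOn-⊆ (edges-unique G) cover)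
        (JOn-reflect (unposition w) id id into))
      where
      into : ∀ i → MapsInto (unposition w) (lookup (onePendant (inject₁ p)) i) (lookup (pathEdges ++ e ∷ []) i)
      into zero = unposition-modelStep w zero
      into (suc zero) = unposition-modelStep w (# 1)
      into (suc (suc zero)) = unposition-modelStep w (# 2)
      into (suc (suc (suc zero))) = unposition-modelStep w (# 3)
      into (suc (suc (suc (suc zero)))) = unposition-e Vp≡x

    from-dichotomy : (position x ≢ offPath × Dissipates (JOn (onePendant (position x)))) ⊎
             (∃ λ p → withinᵇ (graphOf (onePendant (position x))) 4 offPath (inject₁ p) ≡ false) →
             Dec (OnPath x) → Dissipates G
    from-dichotomy (inj₂ (p , far)) _ = contradiction (trans (sym (reaches-path p)) far) λ ()
    from-dichotomy (inj₁ (on , _)) (no x-off) = ⊥-elim (on (position-off x-off))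
    from-dichotomy (inj₁ (_ , dissipative)) (yes (p , Vp≡x)) =
      via-onePendant Vp≡x (subst (Dissipates ∘ JOn ∘ onePendant) (trans (cong position (sym Vp≡x)) (position-V p)) dissipative)

    dissipates : Dissipates G
    dissipates = from-dichotomy (onePendant-dichotomy (position x)) (onPath? x)

  accumulates-if-many : 6 ≤ edgeCount G → AccumulatesC5orNet G
  accumulates-if-many six≤ = two-extra extraEdges refl (ℕ.+-cancelˡ-≤ 4 2 _ (subst (6 ≤_) edgeCount-extra six≤))
    where
    two-extra : ∀ R → extraEdges ≡ R → 2 ≤ length R → AccumulatesC5orNet G
    two-extra (e ∷ f ∷ R) eq _ with subst Unique eq extraEdges-unique
    ... | (e≢f ∷ _) ∷ _ = accumulates-with-two-extra (∈R (here refl)) (∈R (there (here refl))) e≢f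
      where
      ∈R : ∀ {x} → x ∈ e ∷ f ∷ R → x ∈ extraEdges
      ∈R = subst (_ ∈_) (sym eq)
    two-extra (_ ∷ []) _ (s≤s ())

  dissipates-if-few : edgeCount G ≤ 5 → Dissipates G
  dissipates-if-few ≤five = at-most-one extraEdges refl (ℕ.+-cancelˡ-≤ 4 _ 1 (subst (_≤ 5) edgeCount-extra ≤five))
    where
    at-most-one : ∀ R → extraEdges ≡ R → length R ≤ 1 → Dissipates G
    at-most-one [] eq _ = dissipates-without-extra eq
    at-most-one (e ∷ []) eq _ with extra-hangs (subst (e ∈_) (sym eq) (here refl))
    ... | x , w , w-off , e≈ = OneExtra.dissipates eq x w w-off e≈
    at-most-one (_ ∷ _ ∷ _) _ (s≤s ())

  infinite⇒many : DissipationInfinite G → 6 ≤ edgeCount G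
  infinite⇒many infinite with 6 ℕ.≤? edgeCount G
  ... | yes six≤ = six≤
  ... | no ¬six≤ = ⊥-elim (infinite (dissipates-if-few (ℕ.≤-pred (ℕ.≰⇒> ¬six≤))))

mainTheorem12 : (G : Graph) → IsSimple G → HasDiameter G 4 →
    (DissipationInfinite G ⇔ AccumulatesC5orNet G) × (AccumulatesC5orNet G ⇔ 6 ≤ edgeCount G)
mainTheorem12 G simple diameter with diameter-geodesic diameter
... | _ , _ , path , shortest =
  mk⇔ (accumulates-if-many ∘ infinite⇒many) (accumulates⇒infinite sym-G) ,
  mk⇔ (infinite⇒many ∘ accumulates⇒infinite sym-G) accumulates-if-many
  where open Diameter4 G simple (proj₁ diameter) path shortest
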